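{- For any graphs $G_1,G_2,H_1,H_2$, $$\alpha^*(G_1\boxtimes G_2\,|\,H_1\boxtimes H_2)\le \alpha^*(G_1|H_1)\,\alpha^*(G_2|H_2).$$
   Context: All graphs are finite, simple, undirected; $\boxtimes$ is the strong product and $\alpha^*(G|H)=\sup_W\frac{\alpha(G\boxtimes W)}{\alpha(H\boxtimes W)}$ over all graphs $W$, $\alpha$ being the independence number. -}

module Defs where

open import Data.Bool using (Bool; true; false; _∧_; _∨_; not)
open import Data.Nat using (ℕ; zero; suc; _*_; _⊔_)
open import Data.Fin using (Fin; _≟_; combine; remQuot)
open import Data.Fin.Properties using () renaming (_≟_ to _≟F_)
open import Data.Vec using (Vec; []; _∷_; lookup)
open import Data.List using (List; []; _∷_; map; _++_; filterᵇ; foldr; allFin)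
open import Data.Product using (proj₁; proj₂)
open import Relation.Nullary using (does; yes; no)
open import Relation.Binary.PropositionalEquality using (_≡_; refl; sym; cong₂)

record Graph : Set where
  field
    n      : ℕ
    adj    : Fin n → Fin n → Bool
    adj-sym   : ∀ i j → adj i j ≡ adj j i
    adj-irrefl : ∀ i → adj i i ≡ false
open Graph public

eqF : ∀ {k} → Fin k → Fin k → Bool
eqF i j = does (i ≟ j)

eqF-sym : ∀ {k} (i j : Fin k) → eqF i j ≡ eqF j i
eqF-sym i j with i ≟ j | j ≟ i
... | yes _  | yes _ = refl
... | no _   | no _  = refl
... | yes p  | no q  = Data.Empty.⊥-elim (q (sym p))
  where import Data.Empty
... | no p   | yes q = Data.Empty.⊥-elim (p (sym q))
  where import Data.Empty

eqF-refl : ∀ {k} (i : Fin k) → eqF i i ≡ true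
eqF-refl i with i ≟ i
... | yes _ = refl
... | no p  = Data.Empty.⊥-elim (p refl)
  where import Data.Empty

eqOrAdj : (G : Graph) → Fin (n G) → Fin (n G) → Bool
eqOrAdj G u v = eqF u v ∨ adj G u v

eqOrAdj-sym : (G : Graph) → ∀ u v → eqOrAdj G u v ≡ eqOrAdj G v u
eqOrAdj-sym G u v = cong₂ _∨_ (eqF-sym u v) (adj-sym G u v)

-- Strong product G ⊠ H on vertex set Fin (n G * n H) ≅ Fin (n G) × Fin (n H)
-- (via Data.Fin.remQuot, inverse of Data.Fin.combine): distinct (u,v),(u',v')
-- are adjacent iff (u = u' or u ~ u') and (v = v' or v ~ v').
fst : (G H : Graph) → Fin (n G * n H) → Fin (n G)
fst G H x = proj₁ (remQuot {n G} (n H) x)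

snd : (G H : Graph) → Fin (n G * n H) → Fin (n H)
snd G H x = proj₂ (remQuot {n G} (n H) x)

⊠-adj : (G H : Graph) → Fin (n G * n H) → Fin (n G * n H) → Bool
⊠-adj G H x y =
  not (eqF x y) ∧ (eqOrAdj G (fst G H x) (fst G H y) ∧ eqOrAdj H (snd G H x) (snd G H y))

⊠-sym : (G H : Graph) → ∀ x y → ⊠-adj G H x y ≡ ⊠-adj G H y x
⊠-sym G H x y rewrite eqF-sym x y | eqOrAdj-sym G (fst G H x) (fst G H y)
                    | eqOrAdj-sym H (snd G H x) (snd G H y) = refl

⊠-irrefl : (G H : Graph) → ∀ x → ⊠-adj G H x x ≡ false
⊠-irrefl G H x rewrite eqF-refl x = refl

_⊠_ : Graph → Graph → Graph
G ⊠ H = record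
  { n = n G * n H
  ; adj = ⊠-adj G H
  ; adj-sym = ⊠-sym G H
  ; adj-irrefl = ⊠-irrefl G H
  }

infixl 7 _⊠_

subsets : ∀ k → List (Vec Bool k)
subsets zero = [] ∷ []
subsets (suc k) = map (true ∷_) (subsets k) ++ map (false ∷_) (subsets k)

size : ∀ {k} → Vec Bool k → ℕ
size [] = 0
size (true ∷ s) = suc (size s)
size (false ∷ s) = size s

independent : (G : Graph) → Vec Bool (n G) → Bool
independent G S =
  allB (λ i → allB (λ j → not (lookup S i ∧ lookup S j ∧ adj G i j)) (allFin (n G)))
       (allFin (n G))
  where
  allB : ∀ {A : Set} → (A → Bool) → List A → Bool
  allB p xs = foldr _∧_ true (map p xs)

α : Graph → ℕ
α G = foldr _⊔_ 0 (map size (filterᵇ (independent G) (subsets (n G))))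

-- "α*(G|H) ≤ p/q", i.e. p/q is an upper bound of α(G⊠W)/α(H⊠W) over all
-- graphs W, stated cross-multiplied (no division).
α*≤ : Graph → Graph → ℕ → ℕ → Set
α*≤ G H p q = ∀ (W : Graph) → α (G ⊠ W) * q Data.Nat.≤ p * α (H ⊠ W)
  where import Data.Nat

{-# OPTIONS --safe #-}
-- The strong
-- product is associative and commutative up to isomorphism, and α is an isomorphism
-- invariant, so the bound for G₁ at W' = G₂ ⊠ W followed by the bound for G₂ at
-- W'' = H₁ ⊠ W gives
--   α((G₁ ⊠ G₂) ⊠ W) q₁ q₂ ≤ p₁ α(H₁ ⊠ (G₂ ⊠ W)) q₂ = p₁ α(G₂ ⊠ (H₁ ⊠ W)) q₂
--                          ≤ p₁ p₂ α(H₂ ⊠ (H₁ ⊠ W)) = p₁ p₂ α((H₁ ⊠ H₂) ⊠ W).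
module Submission where

open import Data.Bool using (Bool; true; false; T; _∧_; _∨_; not)
open import Data.Bool.Properties using (T-∧; T-∨; ∧-assoc; ∧-comm)
open import Data.Bool.ListAction using (all)
open import Data.Fin using (Fin; zero; suc; _≟_; combine)
open import Data.Fin.Properties using (suc-injective; injective⇒≤; remQuot-combine; combine-remQuot)
open import Data.List using ([]; _∷_; map; filterᵇ; foldr; allFin)
open import Data.List.Membership.Propositional using (_∈_)
open import Data.List.Membership.Propositional.Properties using (∈-map⁺; ∈-++⁺ˡ; ∈-++⁺ʳ)
open import Data.List.Relation.Unary.Any using (here; there)
open import Data.List.Relation.Unary.All.Properties using (all⁺; all⁻; tabulate⁺; tabulate⁻)
open import Data.Nat using (ℕ; suc; _*_; _⊔_; _≤_; z≤n)
open import Data.Nat.Properties using (≤-trans; m≤m⊔n; m≤n⇒m≤o⊔n; ⊔-lub; *-assoc; *-monoˡ-≤; *-monoʳ-≤; module ≤-Reasoning)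
open import Data.Product using (_,_; proj₁; proj₂)
open import Data.Sum using (inj₁; inj₂)
open import Data.Vec using (Vec; []; _∷_; lookup; tabulate)
open import Data.Vec.Properties using (lookup∘tabulate)
open import Function using (_∘_; _⇔_; mk⇔; Equivalence)
open import Function.Definitions using (Injective)
open import Relation.Nullary using (¬_; yes; no; contradiction)
open import Relation.Binary.PropositionalEquality using (_≡_; refl; sym; trans; cong; cong₂; subst; module ≡-Reasoning)
open import Defs

T-not : ∀ {b} → T (not b) ⇔ (¬ T b)
T-not {true}  = mk⇔ (λ ()) (λ ¬⊤ → ¬⊤ _)
T-not {false} = mk⇔ (λ _ ()) (λ _ → _)

all-allFin : ∀ {k} (p : Fin k → Bool) → T (all p (allFin k)) ⇔ (∀ i → T (p i))
all-allFin {k} p = mk⇔ (tabulate⁻ ∘ all⁺ p (allFin k)) (all⁻ p ∘ tabulate⁺)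

eqF⇒≡ : ∀ {k} {i j : Fin k} → T (eqF i j) → i ≡ j
eqF⇒≡ {i = i} {j} i≡ᵇj with i ≟ j
eqF⇒≡ _  | yes i≡j = i≡j
eqF⇒≡ () | no _

eqOrAdj-refl : ∀ G i → T (eqOrAdj G i i)
eqOrAdj-refl G i rewrite eqF-refl i = _

module _ {A : Set} (f : A → ℕ) (p : A → Bool) where

  ⊔-filterᵇ-upper : ∀ {x xs} → x ∈ xs → T (p x) → f x ≤ foldr _⊔_ 0 (map f (filterᵇ p xs))
  ⊔-filterᵇ-upper {x} (here refl) px with p x | px
  ... | true | _ = m≤m⊔n (f x) _
  ⊔-filterᵇ-upper {x} {y ∷ _} (there x∈xs) px with p y
  ... | true  = m≤n⇒m≤o⊔n (f y) (⊔-filterᵇ-upper x∈xs px)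
  ... | false = ⊔-filterᵇ-upper x∈xs px

  ⊔-filterᵇ-least : ∀ {m} xs → (∀ x → T (p x) → f x ≤ m) → foldr _⊔_ 0 (map f (filterᵇ p xs)) ≤ m
  ⊔-filterᵇ-least []       bound = z≤n
  ⊔-filterᵇ-least (x ∷ xs) bound with p x | bound x
  ... | true  | fx≤m = ⊔-lub (fx≤m _) (⊔-filterᵇ-least xs bound)
  ... | false | _    = ⊔-filterᵇ-least xs bound

∈-subsets : ∀ {k} (S : Vec Bool k) → S ∈ subsets k
∈-subsets []                  = here refl
∈-subsets (true ∷ S)          = ∈-++⁺ˡ (∈-map⁺ (true ∷_) (∈-subsets S))
∈-subsets {suc k} (false ∷ S) = ∈-++⁺ʳ (map (true ∷_) (subsets k)) (∈-map⁺ (false ∷_) (∈-subsets S))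

size≤α : ∀ G S → T (independent G S) → size S ≤ α G
size≤α G S = ⊔-filterᵇ-upper size (independent G) (∈-subsets S)

α-lub : ∀ G {m} → (∀ S → T (independent G S) → size S ≤ m) → α G ≤ m
α-lub G = ⊔-filterᵇ-least size (independent G) (subsets (n G))

Independent : (G : Graph) → Vec Bool (n G) → Set
Independent G S = ∀ {i j} → T (lookup S i) → T (lookup S j) → T (eqOrAdj G i j) → i ≡ j

module _ (G : Graph) (S : Vec Bool (n G)) where

  T-independent : T (independent G S) ⇔ (∀ i j → T (not (lookup S i ∧ lookup S j ∧ adj G i j)))
  T-independent = mk⇔
    (λ ind i → Equivalence.to (all-allFin _) (Equivalence.to (all-allFin _) ind i))
    (λ ind → Equivalence.from (all-allFin _) (λ i → Equivalence.from (all-allFin _) (ind i)))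

  independent⇒Independent : T (independent G S) → Independent G S
  independent⇒Independent ind {i} {j} Si Sj i≈j with Equivalence.to T-∨ i≈j
  ... | inj₁ i≡j = eqF⇒≡ i≡j
  ... | inj₂ i~j = contradiction (Equivalence.from T-∧ (Si , Equivalence.from T-∧ (Sj , i~j)))
                                 (Equivalence.to T-not (Equivalence.to T-independent ind i j))

  Independent⇒independent : Independent G S → T (independent G S)
  Independent⇒independent ind = Equivalence.from T-independent λ i j →
    Equivalence.from T-not λ Si∧Sj∧i~j →
      let Si , Sj∧i~j = Equivalence.to T-∧ Si∧Sj∧i~j
          Sj , i~j    = Equivalence.to T-∧ Sj∧i~j
          i≡j         = ind Si Sj (Equivalence.from T-∨ (inj₂ i~j))
      in subst T (adj-irrefl G j) (subst (λ k → T (adj G k j)) i≡j i~j)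

member : ∀ {k} (S : Vec Bool k) → Fin (size S) → Fin k
member (true ∷ S)  zero    = zero
member (true ∷ S)  (suc t) = suc (member S t)
member (false ∷ S) t       = suc (member S t)

member-∈ : ∀ {k} (S : Vec Bool k) t → T (lookup S (member S t))
member-∈ (true ∷ S)  zero    = _
member-∈ (true ∷ S)  (suc t) = member-∈ S t
member-∈ (false ∷ S) t       = member-∈ S t

member-injective : ∀ {k} (S : Vec Bool k) → Injective _≡_ _≡_ (member S)
member-injective (true ∷ S)  {zero}  {zero}  _  = refl
member-injective (true ∷ S)  {suc t} {suc u} eq = cong suc (member-injective S (suc-injective eq))
member-injective (false ∷ S)                 eq = member-injective S (suc-injective eq)

rank : ∀ {k} (S : Vec Bool k) i → T (lookup S i) → Fin (size S)
rank (true ∷ S)  zero    _  = zero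
rank (true ∷ S)  (suc i) Si = suc (rank S i Si)
rank (false ∷ S) (suc i) Si = rank S i Si

rank-injective : ∀ {k} (S : Vec Bool k) {i j} Si Sj → rank S i Si ≡ rank S j Sj → i ≡ j
rank-injective (true ∷ S)  {zero}  {zero}  _  _  _  = refl
rank-injective (true ∷ S)  {suc i} {suc j} Si Sj eq = cong suc (rank-injective S Si Sj (suc-injective eq))
rank-injective (false ∷ S) {suc i} {suc j} Si Sj eq = cong suc (rank-injective S Si Sj eq)

size-≤-injection : ∀ {a b} {S : Vec Bool a} {S′ : Vec Bool b} (h : Fin a → Fin b) →
                   Injective _≡_ _≡_ h → (∀ {i} → T (lookup S i) → T (lookup S′ (h i))) →
                   size S ≤ size S′
size-≤-injection {S = S} {S′} h h-injective h-into = injective⇒≤ {f = rank-h}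
  λ eq → member-injective S (h-injective (rank-injective S′ _ _ eq))
  where
  rank-h : Fin (size S) → Fin (size S′)
  rank-h t = rank S′ (h (member S t)) (h-into (member-∈ S t))

-- For a bijection, preserving "equal or adjacent" is the same as preserving adjacency;
-- it is the relation the strong product multiplies coordinatewise.
infix 4 _≅_

record _≅_ (A B : Graph) : Set where
  field
    to         : Fin (n A) → Fin (n B)
    from       : Fin (n B) → Fin (n A)
    from-to    : ∀ i → from (to i) ≡ i
    to-from    : ∀ j → to (from j) ≡ j
    to-eqOrAdj : ∀ i i′ → eqOrAdj B (to i) (to i′) ≡ eqOrAdj A i i′

  to-injective : Injective _≡_ _≡_ to
  to-injective {i} {i′} eq = trans (sym (from-to i)) (trans (cong from eq) (from-to i′))

≅-sym : ∀ {A B} → A ≅ B → B ≅ A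
≅-sym {A} {B} A≅B = record
  { to = from ; from = to ; from-to = to-from ; to-from = from-to
  ; to-eqOrAdj = λ j j′ → begin
      eqOrAdj A (from j) (from j′)             ≡⟨ to-eqOrAdj (from j) (from j′) ⟨
      eqOrAdj B (to (from j)) (to (from j′))   ≡⟨ cong₂ (eqOrAdj B) (to-from j) (to-from j′) ⟩
      eqOrAdj B j j′                           ∎
  }
  where open _≅_ A≅B; open ≡-Reasoning

≅-trans : ∀ {A B C} → A ≅ B → B ≅ C → A ≅ C
≅-trans A≅B B≅C = record
  { to         = B≅C.to ∘ A≅B.to
  ; from       = A≅B.from ∘ B≅C.from
  ; from-to    = λ i → trans (cong A≅B.from (B≅C.from-to (A≅B.to i))) (A≅B.from-to i)
  ; to-from    = λ k → trans (cong B≅C.to (A≅B.to-from (B≅C.from k))) (B≅C.to-from k)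
  ; to-eqOrAdj = λ i i′ → trans (B≅C.to-eqOrAdj (A≅B.to i) (A≅B.to i′)) (A≅B.to-eqOrAdj i i′)
  }
  where module A≅B = _≅_ A≅B; module B≅C = _≅_ B≅C

module _ {A B : Graph} (A≅B : A ≅ B) where
  open _≅_ A≅B

  transport : Vec Bool (n A) → Vec Bool (n B)
  transport S = tabulate (lookup S ∘ from)

  lookup-transport : ∀ S j → lookup (transport S) j ≡ lookup S (from j)
  lookup-transport S = lookup∘tabulate (lookup S ∘ from)

  transport-Independent : ∀ S → Independent A S → Independent B (transport S)
  transport-Independent S ind {j} {j′} Sj Sj′ j≈j′ = begin
    j             ≡⟨ to-from j ⟨
    to (from j)   ≡⟨ cong to (ind (∈-transport j Sj) (∈-transport j′ Sj′) fromj≈fromj′) ⟩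
    to (from j′)  ≡⟨ to-from j′ ⟩
    j′            ∎
    where
    open ≡-Reasoning
    ∈-transport : ∀ k → T (lookup (transport S) k) → T (lookup S (from k))
    ∈-transport k = subst T (lookup-transport S k)
    fromj≈fromj′ : T (eqOrAdj A (from j) (from j′))
    fromj≈fromj′ = subst T (sym (_≅_.to-eqOrAdj (≅-sym A≅B) j j′)) j≈j′

  transport-independent : ∀ S → T (independent A S) → T (independent B (transport S))
  transport-independent S = Independent⇒independent B (transport S)
                          ∘ transport-Independent S
                          ∘ independent⇒Independent A S

  size-transport : ∀ S → size S ≤ size (transport S)
  size-transport S = size-≤-injection {S = S} {transport S} to to-injective λ {i} Si →
    subst T (sym (trans (lookup-transport S (to i)) (cong (lookup S) (from-to i)))) Si

  ≅⇒α≤ : α A ≤ α B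
  ≅⇒α≤ = α-lub A λ S S-independent →
    ≤-trans (size-transport S) (size≤α B (transport S) (transport-independent S S-independent))

∨-not-∧ : ∀ b c → (T b → T c) → b ∨ (not b ∧ c) ≡ c
∨-not-∧ true  true  _   = refl
∨-not-∧ true  false b⇒c = contradiction _ b⇒c
∨-not-∧ false c     _   = refl

module _ (G H : Graph) where

  fst-combine : ∀ {i j} → fst G H (combine i j) ≡ i
  fst-combine {i} {j} = cong proj₁ (remQuot-combine {n G} {n H} i j)

  snd-combine : ∀ {i j} → snd G H (combine i j) ≡ j
  snd-combine {i} {j} = cong proj₂ (remQuot-combine {n G} {n H} i j)

  combine-fst-snd : ∀ x → combine (fst G H x) (snd G H x) ≡ x
  combine-fst-snd = combine-remQuot {n G} (n H)

  ⊠-eqOrAdj : ∀ x y → eqOrAdj (G ⊠ H) x y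
                    ≡ eqOrAdj G (fst G H x) (fst G H y) ∧ eqOrAdj H (snd G H x) (snd G H y)
  ⊠-eqOrAdj x y = ∨-not-∧ (eqF x y) _ λ x≡ᵇy → coordinates≈ (eqF⇒≡ x≡ᵇy)
    where
    coordinates≈ : x ≡ y → T (eqOrAdj G (fst G H x) (fst G H y) ∧ eqOrAdj H (snd G H x) (snd G H y))
    coordinates≈ refl = Equivalence.from T-∧ (eqOrAdj-refl G (fst G H x) , eqOrAdj-refl H (snd G H x))

  ⊠-eqOrAdj-combine : ∀ {i i′ j j′} → eqOrAdj (G ⊠ H) (combine i j) (combine i′ j′)
                                    ≡ eqOrAdj G i i′ ∧ eqOrAdj H j j′
  ⊠-eqOrAdj-combine {i} {i′} {j} {j′} =
    trans (⊠-eqOrAdj (combine i j) (combine i′ j′))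
          (cong₂ _∧_ (cong₂ (eqOrAdj G) fst-combine fst-combine)
                     (cong₂ (eqOrAdj H) snd-combine snd-combine))

⊠-comm : ∀ A B → A ⊠ B ≅ B ⊠ A
⊠-comm A B = record
  { to         = swap A B
  ; from       = swap B A
  ; from-to    = swap-swap A B
  ; to-from    = swap-swap B A
  ; to-eqOrAdj = λ x y → trans (⊠-eqOrAdj-combine B A)
      (trans (∧-comm (eqOrAdj B (snd A B x) (snd A B y)) (eqOrAdj A (fst A B x) (fst A B y)))
             (sym (⊠-eqOrAdj A B x y)))
  }
  where
  swap : ∀ G H → Fin (n (G ⊠ H)) → Fin (n (H ⊠ G))
  swap G H x = combine (snd G H x) (fst G H x)

  swap-swap : ∀ G H x → swap H G (swap G H x) ≡ x
  swap-swap G H x = trans (cong₂ combine (snd-combine H G) (fst-combine H G)) (combine-fst-snd G H x)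

⊠-congˡ : ∀ {A A′} B → A ≅ A′ → A ⊠ B ≅ A′ ⊠ B
⊠-congˡ {A} {A′} B A≅A′ = record
  { to         = map₁ A A′ to
  ; from       = map₁ A′ A from
  ; from-to    = map₁-inverse A A′ to from from-to
  ; to-from    = map₁-inverse A′ A from to to-from
  ; to-eqOrAdj = λ x y → trans (⊠-eqOrAdj-combine A′ B)
      (trans (cong (_∧ _) (to-eqOrAdj (fst A B x) (fst A B y))) (sym (⊠-eqOrAdj A B x y)))
  }
  where
  open _≅_ A≅A′

  map₁ : ∀ G G′ → (Fin (n G) → Fin (n G′)) → Fin (n (G ⊠ B)) → Fin (n (G′ ⊠ B))
  map₁ G G′ f x = combine (f (fst G B x)) (snd G B x)

  map₁-inverse : ∀ G G′ f g → (∀ i → g (f i) ≡ i) → ∀ x → map₁ G′ G g (map₁ G G′ f x) ≡ x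
  map₁-inverse G G′ f g g∘f x =
    trans (cong₂ combine (trans (cong g (fst-combine G′ B)) (g∘f _)) (snd-combine G′ B))
          (combine-fst-snd G B x)

⊠-assoc : ∀ A B C → (A ⊠ B) ⊠ C ≅ A ⊠ (B ⊠ C)
⊠-assoc A B C = record
  { to = to ; from = from ; from-to = from-to ; to-from = to-from ; to-eqOrAdj = to-eqOrAdj }
  where
  open ≡-Reasoning
  AB BC : Graph
  AB = A ⊠ B
  BC = B ⊠ C

  to : Fin (n (AB ⊠ C)) → Fin (n (A ⊠ BC))
  to x = combine (fst A B (fst AB C x)) (combine (snd A B (fst AB C x)) (snd AB C x))

  from : Fin (n (A ⊠ BC)) → Fin (n (AB ⊠ C))
  from y = combine (combine (fst A BC y) (fst B C (snd A BC y))) (snd B C (snd A BC y))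

  from-to : ∀ x → from (to x) ≡ x
  from-to x = begin
    from (to x)
      ≡⟨ cong₂ combine
           (cong₂ combine (fst-combine A BC) (trans (cong (fst B C) (snd-combine A BC)) (fst-combine B C)))
           (trans (cong (snd B C) (snd-combine A BC)) (snd-combine B C)) ⟩
    combine (combine (fst A B (fst AB C x)) (snd A B (fst AB C x))) (snd AB C x)
      ≡⟨ cong (λ u → combine u (snd AB C x)) (combine-fst-snd A B (fst AB C x)) ⟩
    combine (fst AB C x) (snd AB C x)
      ≡⟨ combine-fst-snd AB C x ⟩
    x ∎

  to-from : ∀ y → to (from y) ≡ y
  to-from y = begin
    to (from y)
      ≡⟨ cong₂ combine
           (trans (cong (fst A B) (fst-combine AB C)) (fst-combine A B))
           (cong₂ combine (trans (cong (snd A B) (fst-combine AB C)) (snd-combine A B)) (snd-combine AB C)) ⟩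
    combine (fst A BC y) (combine (fst B C (snd A BC y)) (snd B C (snd A BC y)))
      ≡⟨ cong (combine (fst A BC y)) (combine-fst-snd B C (snd A BC y)) ⟩
    combine (fst A BC y) (snd A BC y)
      ≡⟨ combine-fst-snd A BC y ⟩
    y ∎

  to-eqOrAdj : ∀ x x′ → eqOrAdj (A ⊠ BC) (to x) (to x′) ≡ eqOrAdj (AB ⊠ C) x x′
  to-eqOrAdj x x′ = begin
    eqOrAdj (A ⊠ BC) (to x) (to x′)                  ≡⟨ ⊠-eqOrAdj-combine A BC ⟩
    a≈ ∧ eqOrAdj BC (combine b c) (combine b′ c′)    ≡⟨ cong (a≈ ∧_) (⊠-eqOrAdj-combine B C) ⟩
    a≈ ∧ (b≈ ∧ c≈)                                   ≡⟨ ∧-assoc a≈ b≈ c≈ ⟨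
    (a≈ ∧ b≈) ∧ c≈                                   ≡⟨ cong (_∧ c≈) (⊠-eqOrAdj A B (fst AB C x) (fst AB C x′)) ⟨
    eqOrAdj AB (fst AB C x) (fst AB C x′) ∧ c≈       ≡⟨ ⊠-eqOrAdj AB C x x′ ⟨
    eqOrAdj (AB ⊠ C) x x′                            ∎
    where
    a a′ : Fin (n A)
    a  = fst A B (fst AB C x)
    a′ = fst A B (fst AB C x′)
    b b′ : Fin (n B)
    b  = snd A B (fst AB C x)
    b′ = snd A B (fst AB C x′)
    c c′ : Fin (n C)
    c  = snd AB C x
    c′ = snd AB C x′
    a≈ b≈ c≈ : Bool
    a≈ = eqOrAdj A a a′
    b≈ = eqOrAdj B b b′
    c≈ = eqOrAdj C c c′

⊠-exchange : ∀ A B C → A ⊠ (B ⊠ C) ≅ B ⊠ (A ⊠ C)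
⊠-exchange A B C =
  ≅-trans (≅-sym (⊠-assoc A B C)) (≅-trans (⊠-congˡ C (⊠-comm A B)) (⊠-assoc B A C))

lemma1 : (G₁ G₂ H₁ H₂ : Graph) (p₁ q₁ p₂ q₂ : ℕ) →
    α*≤ G₁ H₁ p₁ q₁ → α*≤ G₂ H₂ p₂ q₂ →
    α*≤ (G₁ ⊠ G₂) (H₁ ⊠ H₂) (p₁ * p₂) (q₁ * q₂)
lemma1 G₁ G₂ H₁ H₂ p₁ q₁ p₂ q₂ G₁/H₁≤p₁/q₁ G₂/H₂≤p₂/q₂ W = begin
  α ((G₁ ⊠ G₂) ⊠ W) * (q₁ * q₂)  ≤⟨ *-monoˡ-≤ (q₁ * q₂) (≅⇒α≤ (⊠-assoc G₁ G₂ W)) ⟩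
  α (G₁ ⊠ (G₂ ⊠ W)) * (q₁ * q₂)  ≡⟨ *-assoc (α (G₁ ⊠ (G₂ ⊠ W))) q₁ q₂ ⟨
  α (G₁ ⊠ (G₂ ⊠ W)) * q₁ * q₂    ≤⟨ *-monoˡ-≤ q₂ (G₁/H₁≤p₁/q₁ (G₂ ⊠ W)) ⟩
  p₁ * α (H₁ ⊠ (G₂ ⊠ W)) * q₂    ≤⟨ *-monoˡ-≤ q₂ (*-monoʳ-≤ p₁ (≅⇒α≤ (⊠-exchange H₁ G₂ W))) ⟩
  p₁ * α (G₂ ⊠ (H₁ ⊠ W)) * q₂    ≡⟨ *-assoc p₁ (α (G₂ ⊠ (H₁ ⊠ W))) q₂ ⟩
  p₁ * (α (G₂ ⊠ (H₁ ⊠ W)) * q₂)  ≤⟨ *-monoʳ-≤ p₁ (G₂/H₂≤p₂/q₂ (H₁ ⊠ W)) ⟩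
  p₁ * (p₂ * α (H₂ ⊠ (H₁ ⊠ W)))  ≤⟨ *-monoʳ-≤ p₁ (*-monoʳ-≤ p₂ (≅⇒α≤ H₂⊠H₁⊠W≅H₁⊠H₂⊠W)) ⟩
  p₁ * (p₂ * α ((H₁ ⊠ H₂) ⊠ W))  ≡⟨ *-assoc p₁ p₂ (α ((H₁ ⊠ H₂) ⊠ W)) ⟨
  p₁ * p₂ * α ((H₁ ⊠ H₂) ⊠ W)    ∎
  where
  open ≤-Reasoning
  H₂⊠H₁⊠W≅H₁⊠H₂⊠W : H₂ ⊠ (H₁ ⊠ W) ≅ (H₁ ⊠ H₂) ⊠ W
  H₂⊠H₁⊠W≅H₁⊠H₂⊠W = ≅-trans (⊠-exchange H₂ H₁ W) (≅-sym (⊠-assoc H₁ H₂ W))
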